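{- Let $T$ be a tree and $S$ a labeling of $T$ such that $(T,S)\in\mathscr{T}$. Then for any leaf $v$ of $T$ there exists a set $X\subseteq V(T)$ with $|X|=\gamma_t(T)-1$ and $v\in X$ such that every vertex of $T$ other than $v$ has a neighbor in $X$.
   Context: $\gamma_t(G)$ is the total domination number of $G$ (minimum size of a set $D$ such that every vertex of $G$ has a neighbor in $D$). A labeling of a tree $T$ is a weak partition $S=(S_A,S_B,S_C)$ of $V(T)$ (some parts may be empty); the status of $v$ is the letter $x\in\{A,B,C\}$ with $v\in S_x$. The family $\mathscr{T}$ of labeled trees $(T,S)$ is the smallest family that (i) contains $(P_6,S_0)$, where $S_0$ gives the two leaves of $P_6$ status $C$, the two support vertices status $A$, and the two central vertices status $B$; and (ii) is closed under the operation $\mathscr{O}$: given $(T',S')\in\mathscr{T}$ and a vertex $v$ of $T'$ with status $B$, add a new path $u_1u_2u_3u_4u_5u_6$ and the edge $u_3v$, keep all old statuses, and give $u_1,u_6$ status $C$, $u_2,u_5$ status $A$, and $u_3,u_4$ status $B$. -}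

module Defs where

open import Data.Nat using (ℕ; _≤_)
open import Data.Fin using (Fin; zero; suc; _↑ˡ_; _↑ʳ_; splitAt; #_)
open import Data.Fin.Subset using (Subset; _∈_; ∣_∣)
open import Data.List using (List; []; _∷_; map; _++_)
import Data.List.Membership.Propositional as LM
open import Data.Product using (_×_; _,_; ∃; ∃-syntax; Σ-syntax)
open import Data.Sum using (_⊎_; inj₁; inj₂; [_,_])
open import Relation.Binary.PropositionalEquality using (_≡_)

Edges : ℕ → Set
Edges n = List (Fin n × Fin n)

Adj : ∀ {n} → Edges n → Fin n → Fin n → Set
Adj E x y = ((x , y) LM.∈ E) ⊎ ((y , x) LM.∈ E)

Leaf : ∀ {n} → Edges n → Fin n → Set
Leaf E v = ∃[ u ] (Adj E v u × (∀ w → Adj E v w → w ≡ u))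

TotalDominating : ∀ {n} → Edges n → Subset n → Set
TotalDominating {n} E D = (x : Fin n) → ∃[ y ] (y ∈ D × Adj E x y)

IsTotalDominationNumber : ∀ {n} → Edges n → ℕ → Set
IsTotalDominationNumber {n} E k =
  (∃[ D ] (TotalDominating E D × ∣ D ∣ ≡ k)) ×
  ((D : Subset n) → TotalDominating E D → k ≤ ∣ D ∣)

data Status : Set where
  A B C : Status

pathStatus : Fin 6 → Status
pathStatus zero = C
pathStatus (suc zero) = A
pathStatus (suc (suc zero)) = B
pathStatus (suc (suc (suc zero))) = B
pathStatus (suc (suc (suc (suc zero)))) = A
pathStatus (suc (suc (suc (suc (suc zero))))) = C

-- Edges of the path P6 on Fin 6: 0-1-2-3-4-5 (vertex i is u_{i+1})
P6Edges : Edges 6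
P6Edges = (# 0 , # 1) ∷ (# 1 , # 2) ∷ (# 2 , # 3) ∷ (# 3 , # 4) ∷ (# 4 , # 5) ∷ []

-- Operation O: the new vertices u1..u6 are n ↑ʳ 0 .. n ↑ʳ 5,
-- old vertices are embedded by _↑ˡ 6; u3 (= n ↑ʳ 2) is joined to v.
opEdges : ∀ {n} → Edges n → Fin n → Edges (n Data.Nat.+ 6)
opEdges {n} E v =
  map (λ { (x , y) → (x ↑ˡ 6 , y ↑ˡ 6) }) E
  ++ map (λ { (x , y) → (n ↑ʳ x , n ↑ʳ y) }) P6Edges
  ++ ((n ↑ʳ (# 2) , v ↑ˡ 6) ∷ [])

opStatus : ∀ {n} → (Fin n → Status) → Fin (n Data.Nat.+ 6) → Status
opStatus {n} S x = [ S , pathStatus ] (splitAt n x)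

data InFamily : (n : ℕ) → Edges n → (Fin n → Status) → Set where
  base : InFamily 6 P6Edges pathStatus
  op   : ∀ {n E S} → InFamily n E S → (v : Fin n) → S v ≡ B →
         InFamily (n Data.Nat.+ 6) (opEdges E v) (opStatus S)

-- Every tree of the family consists of k copies u1 … u6 of P6, and its A- and B-vertices
-- (u2 … u5 in every copy) form a total dominating set of size 4k. Conversely, every total
-- dominating set meets each copy in at least four vertices, because the C- and A-vertices
-- of a copy have all their neighbours inside it; so γ_t = 4k. For a leaf v = u1 of a copy,
-- replacing u2 … u5 there by u1, u4, u5 gives a set of size 4k − 1 that contains v and
-- dominates every vertex except v.
module Submission where

open import Defs
open import Data.Nat using (ℕ; suc; _+_; _∸_; _≤_; _≤?_)
open import Data.Nat.Properties
  using (+-suc; +-mono-≤; ≤-trans; ≤-reflexive; ≤-antisym; module ≤-Reasoning)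
open import Data.Fin using (Fin; #_; _↑ˡ_; _↑ʳ_; splitAt)
open import Data.Fin.Properties
  using (all?; any?; splitAt-↑ˡ; splitAt-↑ʳ; splitAt⁻¹-↑ˡ; splitAt⁻¹-↑ʳ; ↑ˡ-injective; ↑ʳ-injective)
  renaming (_≟_ to _≟ᶠ_)
open import Data.Fin.Subset using (Subset; _∈_; ∣_∣; inside; outside)
open import Data.Fin.Subset.Properties using (_∈?_; anySubset?)
open import Data.Vec using ([]; _∷_; _++_)
import Data.Vec as Vec
open import Data.Vec.Properties using (lookup-++ˡ; lookup-++ʳ; []=⇒lookup; lookup⇒[]=)
open import Data.List using (map)
import Data.List.Membership.Propositional as List
import Data.List.Membership.DecPropositional as DecMembership
open import Data.List.Membership.Propositional.Properties
  using (∈-++⁻; ∈-++⁺ˡ; ∈-++⁺ʳ; ∈-map⁻; ∈-map⁺)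
open import Data.List.Relation.Unary.Any using (here)
open import Data.Product using (_×_; _,_; proj₁; proj₂; ∃-syntax)
import Data.Product as Product
open import Data.Product.Properties using (≡-dec)
open import Data.Sum using (_⊎_; inj₁; inj₂; [_,_])
open import Data.Empty using (⊥-elim)
open import Function using (_∘_)
open import Relation.Binary.PropositionalEquality
  using (_≡_; _≢_; refl; sym; trans; cong; subst; subst₂; module ≡-Reasoning)
open import Relation.Nullary using (Dec; yes; no; ¬?)
open import Relation.Nullary.Decidable
  using (_×-dec_; _⊎-dec_; _→-dec_; map′; decidable-stable; toWitness)
open import Relation.Unary using (Pred; Decidable)

HasNeighbourIn : ∀ {n} → Edges n → Subset n → Fin n → Set
HasNeighbourIn E D x = ∃[ y ] (y ∈ D × Adj E x y)

TotalDominatingExcept : ∀ {n} → Edges n → Fin n → Subset n → Set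
TotalDominatingExcept E v D = ∀ x → x ≢ v → HasNeighbourIn E D x

PuncturedDominator : ∀ {n} → Edges n → ℕ → Fin n → Set
PuncturedDominator E k v = ∃[ X ] (suc ∣ X ∣ ≡ k × v ∈ X × TotalDominatingExcept E v X)

AtMostOneNeighbour : ∀ {n} → Edges n → Fin n → Set
AtMostOneNeighbour E x = ∀ a b → Adj E x a → Adj E x b → a ≡ b

Adj-sym : ∀ {n} {E : Edges n} {x y} → Adj E x y → Adj E y x
Adj-sym (inj₁ p) = inj₂ p
Adj-sym (inj₂ p) = inj₁ p

Leaf⇒AtMostOneNeighbour : ∀ {n} {E : Edges n} {v} → Leaf E v → AtMostOneNeighbour E v
Leaf⇒AtMostOneNeighbour (_ , _ , unique) a b p q = trans (unique a p) (sym (unique b q))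

adj? : ∀ {n} (E : Edges n) x y → Dec (Adj E x y)
adj? {n} E x y = ((x , y) ∈ᴱ? E) ⊎-dec ((y , x) ∈ᴱ? E)
  where open DecMembership (≡-dec (_≟ᶠ_ {n}) _≟ᶠ_) using () renaming (_∈?_ to _∈ᴱ?_)

hasNeighbourIn? : ∀ {n} (E : Edges n) D x → Dec (HasNeighbourIn E D x)
hasNeighbourIn? E D x = any? (λ y → (y ∈? D) ×-dec adj? E x y)

allSubset? : ∀ {n ℓ} {P : Pred (Subset n) ℓ} → Decidable P → Dec (∀ p → P p)
allSubset? P? = map′ (λ ∄¬P p → decidable-stable (P? p) (λ ¬Pp → ∄¬P (p , ¬Pp)))
                     (λ ∀P (p , ¬Pp) → ¬Pp (∀P p))
                     (¬? (anySubset? (¬? ∘ P?)))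

isB? : ∀ s → Dec (s ≡ B)
isB? A = no λ ()
isB? B = yes refl
isB? C = no λ ()

x∈p⇒x↑ˡ∈p++q : ∀ {m n} {p : Subset m} {q : Subset n} {x} → x ∈ p → x ↑ˡ n ∈ p ++ q
x∈p⇒x↑ˡ∈p++q {p = p} {q} {x} x∈p = lookup⇒[]= _ _ (trans (lookup-++ˡ p q x) ([]=⇒lookup x∈p))

x↑ˡ∈p++q⇒x∈p : ∀ {m n} {p : Subset m} {q : Subset n} {x} → x ↑ˡ n ∈ p ++ q → x ∈ p
x↑ˡ∈p++q⇒x∈p {p = p} {q} {x} x∈p++q =
  lookup⇒[]= _ _ (trans (sym (lookup-++ˡ p q x)) ([]=⇒lookup x∈p++q))

x∈q⇒m↑ʳx∈p++q : ∀ {m n} {p : Subset m} {q : Subset n} {x} → x ∈ q → m ↑ʳ x ∈ p ++ q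
x∈q⇒m↑ʳx∈p++q {p = p} {q} {x} x∈q = lookup⇒[]= _ _ (trans (lookup-++ʳ p q x) ([]=⇒lookup x∈q))

m↑ʳx∈p++q⇒x∈q : ∀ {m n} {p : Subset m} {q : Subset n} {x} → m ↑ʳ x ∈ p ++ q → x ∈ q
m↑ʳx∈p++q⇒x∈q {p = p} {q} {x} x∈p++q =
  lookup⇒[]= _ _ (trans (sym (lookup-++ʳ p q x)) ([]=⇒lookup x∈p++q))

∣p++q∣≡∣p∣+∣q∣ : ∀ {m n} (p : Subset m) (q : Subset n) → ∣ p ++ q ∣ ≡ ∣ p ∣ + ∣ q ∣
∣p++q∣≡∣p∣+∣q∣ []            q = refl
∣p++q∣≡∣p∣+∣q∣ (inside ∷ p)  q = cong suc (∣p++q∣≡∣p∣+∣q∣ p q)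
∣p++q∣≡∣p∣+∣q∣ (outside ∷ p) q = ∣p++q∣≡∣p∣+∣q∣ p q

suc∣p∣≡∣p′∣⇒suc∣p++q∣≡∣p′++q∣ : ∀ {m n} {p p′ : Subset m} (q : Subset n) →
  suc ∣ p ∣ ≡ ∣ p′ ∣ → suc ∣ p ++ q ∣ ≡ ∣ p′ ++ q ∣
suc∣p∣≡∣p′∣⇒suc∣p++q∣≡∣p′++q∣ {p = p} {p′} q eq = begin
  suc ∣ p ++ q ∣      ≡⟨ cong suc (∣p++q∣≡∣p∣+∣q∣ p q) ⟩
  suc ∣ p ∣ + ∣ q ∣   ≡⟨ cong (_+ ∣ q ∣) eq ⟩
  ∣ p′ ∣ + ∣ q ∣      ≡⟨ sym (∣p++q∣≡∣p∣+∣q∣ p′ q) ⟩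
  ∣ p′ ++ q ∣         ∎
  where open ≡-Reasoning

suc∣q∣≡∣q′∣⇒suc∣p++q∣≡∣p++q′∣ : ∀ {m n} (p : Subset m) {q q′ : Subset n} →
  suc ∣ q ∣ ≡ ∣ q′ ∣ → suc ∣ p ++ q ∣ ≡ ∣ p ++ q′ ∣
suc∣q∣≡∣q′∣⇒suc∣p++q∣≡∣p++q′∣ p {q} {q′} eq = begin
  suc ∣ p ++ q ∣      ≡⟨ cong suc (∣p++q∣≡∣p∣+∣q∣ p q) ⟩
  suc (∣ p ∣ + ∣ q ∣) ≡⟨ sym (+-suc ∣ p ∣ ∣ q ∣) ⟩
  ∣ p ∣ + suc ∣ q ∣   ≡⟨ cong (∣ p ∣ +_) eq ⟩
  ∣ p ∣ + ∣ q′ ∣      ≡⟨ sym (∣p++q∣≡∣p∣+∣q∣ p q′) ⟩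
  ∣ p ++ q′ ∣         ∎
  where open ≡-Reasoning

data SplitView (m n : ℕ) : Fin (m + n) → Set where
  ↑ˡ-view : ∀ i → SplitView m n (i ↑ˡ n)
  ↑ʳ-view : ∀ j → SplitView m n (m ↑ʳ j)

splitView : ∀ m n i → SplitView m n i
splitView m n i with splitAt m i in eq
... | inj₁ x = subst (SplitView m n) (splitAt⁻¹-↑ˡ eq) (↑ˡ-view x)
... | inj₂ j = subst (SplitView m n) (splitAt⁻¹-↑ʳ eq) (↑ʳ-view j)

P6-core : Subset 6
P6-core = outside ∷ inside ∷ inside ∷ inside ∷ inside ∷ outside ∷ []

P6-core-totalDominating : TotalDominating P6Edges P6-core
P6-core-totalDominating = toWitness {a? = all? (hasNeighbourIn? P6Edges P6-core)} _

-- u1 and u6 force u2 and u5, while u2 and u5 each force a further vertex among u1, u3 and u4, u6.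
P6-core-minimal : ∀ R → (∀ j → pathStatus j ≢ B → HasNeighbourIn P6Edges R j) → ∣ P6-core ∣ ≤ ∣ R ∣
P6-core-minimal = toWitness {a? = allSubset? λ R →
  all? (λ j → ¬? (isB? (pathStatus j)) →-dec hasNeighbourIn? P6Edges R j) →-dec
  ∣ P6-core ∣ ≤? ∣ R ∣} _

P6-atMostOneNeighbour⇒end : ∀ j → AtMostOneNeighbour P6Edges j → j ≡ # 0 ⊎ j ≡ # 5
P6-atMostOneNeighbour⇒end = toWitness {a? = all? λ j →
  all? (λ a → all? λ b → adj? P6Edges j a →-dec adj? P6Edges j b →-dec a ≟ᶠ b) →-dec
  (j ≟ᶠ # 0 ⊎-dec j ≟ᶠ # 5)} _

P6-punctured₀ : PuncturedDominator P6Edges ∣ P6-core ∣ (# 0)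
P6-punctured₀ = Y , refl , lookup⇒[]= (# 0) Y refl ,
  toWitness {a? = all? λ x → ¬? (x ≟ᶠ # 0) →-dec hasNeighbourIn? P6Edges Y x} _
  where
  Y : Subset 6
  Y = inside ∷ outside ∷ outside ∷ inside ∷ inside ∷ outside ∷ []

P6-punctured₅ : PuncturedDominator P6Edges ∣ P6-core ∣ (# 5)
P6-punctured₅ = Y , refl , lookup⇒[]= (# 5) Y refl ,
  toWitness {a? = all? λ x → ¬? (x ≟ᶠ # 5) →-dec hasNeighbourIn? P6Edges Y x} _
  where
  Y : Subset 6
  Y = outside ∷ inside ∷ inside ∷ outside ∷ outside ∷ inside ∷ []

P6-punctured : ∀ j → AtMostOneNeighbour P6Edges j → PuncturedDominator P6Edges ∣ P6-core ∣ j
P6-punctured j unique =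
  [ (λ { refl → P6-punctured₀ }) , (λ { refl → P6-punctured₅ }) ]
    (P6-atMostOneNeighbour⇒end j unique)

opStatus-↑ˡ : ∀ {n} (S : Fin n → Status) x → opStatus S (x ↑ˡ 6) ≡ S x
opStatus-↑ˡ {n} S x = cong [ S , pathStatus ] (splitAt-↑ˡ n x 6)

opStatus-↑ʳ : ∀ {n} (S : Fin n → Status) j → opStatus S (n ↑ʳ j) ≡ pathStatus j
opStatus-↑ʳ {n} S j = cong [ S , pathStatus ] (splitAt-↑ʳ n 6 j)

module Operation {n : ℕ} (E : Edges n) (v : Fin n) where

  private
    E⁺ : Edges (n + 6)
    E⁺ = opEdges E v

    newEdge : Fin 6 × Fin 6 → Fin (n + 6) × Fin (n + 6)
    newEdge = Product.map (n ↑ʳ_) (n ↑ʳ_)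

  OpAdj : Fin n ⊎ Fin 6 → Fin n ⊎ Fin 6 → Set
  OpAdj (inj₁ x) (inj₁ y) = Adj E x y
  OpAdj (inj₁ x) (inj₂ j) = x ≡ v × j ≡ # 2
  OpAdj (inj₂ i) (inj₁ y) = i ≡ # 2 × y ≡ v
  OpAdj (inj₂ i) (inj₂ j) = Adj P6Edges i j

  OpAdj-sym : ∀ a b → OpAdj a b → OpAdj b a
  OpAdj-sym (inj₁ x) (inj₁ y) xy = Adj-sym xy
  OpAdj-sym (inj₁ x) (inj₂ j) (x≡v , j≡2) = j≡2 , x≡v
  OpAdj-sym (inj₂ i) (inj₁ y) (i≡2 , y≡v) = y≡v , i≡2
  OpAdj-sym (inj₂ i) (inj₂ j) ij = Adj-sym ij

  opEdge⇒OpAdj : ∀ {a b} → (a , b) List.∈ E⁺ → OpAdj (splitAt n a) (splitAt n b)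
  opEdge⇒OpAdj p with ∈-++⁻ (map _ E) p
  ... | inj₁ q with ∈-map⁻ {A = Fin n × Fin n} _ q
  ...   | (x , y) , e , refl rewrite splitAt-↑ˡ n x 6 | splitAt-↑ˡ n y 6 = inj₁ e
  opEdge⇒OpAdj p | inj₂ q with ∈-++⁻ (map newEdge P6Edges) q
  ... | inj₁ r with ∈-map⁻ newEdge r
  ...   | (i , j) , e , refl rewrite splitAt-↑ʳ n 6 i | splitAt-↑ʳ n 6 j = inj₁ e
  opEdge⇒OpAdj p | inj₂ q | inj₂ (here refl)
    rewrite splitAt-↑ʳ n 6 (# 2) | splitAt-↑ˡ n v 6 = refl , refl

  Adj⇒OpAdj : ∀ {a b} → Adj E⁺ a b → OpAdj (splitAt n a) (splitAt n b)
  Adj⇒OpAdj (inj₁ p) = opEdge⇒OpAdj p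
  Adj⇒OpAdj {a} {b} (inj₂ p) = OpAdj-sym (splitAt n b) (splitAt n a) (opEdge⇒OpAdj p)

  Adj-↑ˡ⁺ : ∀ {x y} → Adj E x y → Adj E⁺ (x ↑ˡ 6) (y ↑ˡ 6)
  Adj-↑ˡ⁺ (inj₁ p) = inj₁ (∈-++⁺ˡ (∈-map⁺ _ p))
  Adj-↑ˡ⁺ (inj₂ p) = inj₂ (∈-++⁺ˡ (∈-map⁺ _ p))

  Adj-↑ʳ⁺ : ∀ {i j} → Adj P6Edges i j → Adj E⁺ (n ↑ʳ i) (n ↑ʳ j)
  Adj-↑ʳ⁺ (inj₁ p) = inj₁ (∈-++⁺ʳ _ (∈-++⁺ˡ (∈-map⁺ newEdge p)))
  Adj-↑ʳ⁺ (inj₂ p) = inj₂ (∈-++⁺ʳ _ (∈-++⁺ˡ (∈-map⁺ newEdge p)))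

  Adj-↑ˡ⁻ : ∀ {x y} → Adj E⁺ (x ↑ˡ 6) (y ↑ˡ 6) → Adj E x y
  Adj-↑ˡ⁻ {x} {y} xy = subst₂ OpAdj (splitAt-↑ˡ n x 6) (splitAt-↑ˡ n y 6) (Adj⇒OpAdj xy)

  Adj-↑ʳ⁻ : ∀ {i j} → Adj E⁺ (n ↑ʳ i) (n ↑ʳ j) → Adj P6Edges i j
  Adj-↑ʳ⁻ {i} {j} ij = subst₂ OpAdj (splitAt-↑ʳ n 6 i) (splitAt-↑ʳ n 6 j) (Adj⇒OpAdj ij)

  Adj-↑ˡ↑ʳ⁻ : ∀ {x j} → Adj E⁺ (x ↑ˡ 6) (n ↑ʳ j) → x ≡ v × j ≡ # 2
  Adj-↑ˡ↑ʳ⁻ {x} {j} xj = subst₂ OpAdj (splitAt-↑ˡ n x 6) (splitAt-↑ʳ n 6 j) (Adj⇒OpAdj xj)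

  module _ {L : Subset n} {R : Subset 6} where

    hasNeighbourIn-↑ˡ⁺ : ∀ {x} → HasNeighbourIn E L x → HasNeighbourIn E⁺ (L ++ R) (x ↑ˡ 6)
    hasNeighbourIn-↑ˡ⁺ (y , y∈L , xy) = y ↑ˡ 6 , x∈p⇒x↑ˡ∈p++q y∈L , Adj-↑ˡ⁺ xy

    hasNeighbourIn-↑ʳ⁺ : ∀ {j} → HasNeighbourIn P6Edges R j → HasNeighbourIn E⁺ (L ++ R) (n ↑ʳ j)
    hasNeighbourIn-↑ʳ⁺ (i , i∈R , ji) = n ↑ʳ i , x∈q⇒m↑ʳx∈p++q i∈R , Adj-↑ʳ⁺ ji

    hasNeighbourIn-↑ˡ⁻ : ∀ {x} → x ≢ v → HasNeighbourIn E⁺ (L ++ R) (x ↑ˡ 6) → HasNeighbourIn E L x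
    hasNeighbourIn-↑ˡ⁻ x≢v (y , y∈L++R , xy) with splitView n 6 y
    ... | ↑ˡ-view y′ = y′ , x↑ˡ∈p++q⇒x∈p y∈L++R , Adj-↑ˡ⁻ xy
    ... | ↑ʳ-view j  = ⊥-elim (x≢v (proj₁ (Adj-↑ˡ↑ʳ⁻ xy)))

    hasNeighbourIn-↑ʳ⁻ : ∀ {j} → j ≢ # 2 →
      HasNeighbourIn E⁺ (L ++ R) (n ↑ʳ j) → HasNeighbourIn P6Edges R j
    hasNeighbourIn-↑ʳ⁻ j≢2 (y , y∈L++R , jy) with splitView n 6 y
    ... | ↑ˡ-view x = ⊥-elim (j≢2 (proj₂ (Adj-↑ˡ↑ʳ⁻ (Adj-sym jy))))
    ... | ↑ʳ-view i = i , m↑ʳx∈p++q⇒x∈q y∈L++R , Adj-↑ʳ⁻ jy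

    ++-totalDominating : TotalDominating E L → TotalDominating P6Edges R → TotalDominating E⁺ (L ++ R)
    ++-totalDominating L-dom R-dom a with splitView n 6 a
    ... | ↑ˡ-view x = hasNeighbourIn-↑ˡ⁺ (L-dom x)
    ... | ↑ʳ-view j = hasNeighbourIn-↑ʳ⁺ (R-dom j)

  punctured-↑ˡ : ∀ {D : Subset n} {R : Subset 6} {x} → TotalDominating P6Edges R →
    PuncturedDominator E ∣ D ∣ x → PuncturedDominator E⁺ ∣ D ++ R ∣ (x ↑ˡ 6)
  punctured-↑ˡ {D} {R} {x} R-dom (X , size , x∈X , X-dom) =
    X ++ R , suc∣p∣≡∣p′∣⇒suc∣p++q∣≡∣p′++q∣ {p = X} {D} R size , x∈p⇒x↑ˡ∈p++q x∈X , dom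
    where
    dom : TotalDominatingExcept E⁺ (x ↑ˡ 6) (X ++ R)
    dom a a≢x with splitView n 6 a
    ... | ↑ˡ-view y = hasNeighbourIn-↑ˡ⁺ (X-dom y (a≢x ∘ cong (_↑ˡ 6)))
    ... | ↑ʳ-view j = hasNeighbourIn-↑ʳ⁺ (R-dom j)

  punctured-↑ʳ : ∀ {D : Subset n} {R : Subset 6} {j} → TotalDominating E D →
    PuncturedDominator P6Edges ∣ R ∣ j → PuncturedDominator E⁺ ∣ D ++ R ∣ (n ↑ʳ j)
  punctured-↑ʳ {D} {R} {j} D-dom (Y , size , j∈Y , Y-dom) =
    D ++ Y , suc∣q∣≡∣q′∣⇒suc∣p++q∣≡∣p++q′∣ D {Y} {R} size , x∈q⇒m↑ʳx∈p++q j∈Y , dom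
    where
    dom : TotalDominatingExcept E⁺ (n ↑ʳ j) (D ++ Y)
    dom a a≢j with splitView n 6 a
    ... | ↑ˡ-view x = hasNeighbourIn-↑ˡ⁺ (D-dom x)
    ... | ↑ʳ-view i = hasNeighbourIn-↑ʳ⁺ (Y-dom i (a≢j ∘ cong (n ↑ʳ_)))

  atMostOneNeighbour-↑ˡ⁻ : ∀ {x} → AtMostOneNeighbour E⁺ (x ↑ˡ 6) → AtMostOneNeighbour E x
  atMostOneNeighbour-↑ˡ⁻ unique a b xa xb = ↑ˡ-injective 6 a b (unique _ _ (Adj-↑ˡ⁺ xa) (Adj-↑ˡ⁺ xb))

  atMostOneNeighbour-↑ʳ⁻ : ∀ {j} → AtMostOneNeighbour E⁺ (n ↑ʳ j) → AtMostOneNeighbour P6Edges j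
  atMostOneNeighbour-↑ʳ⁻ unique a b ja jb = ↑ʳ-injective n a b (unique _ _ (Adj-↑ʳ⁺ ja) (Adj-↑ʳ⁺ jb))

core : ∀ {n E S} → InFamily n E S → Subset n
core base       = P6-core
core (op F _ _) = core F ++ P6-core

core-totalDominating : ∀ {n E S} (F : InFamily n E S) → TotalDominating E (core F)
core-totalDominating base = P6-core-totalDominating
core-totalDominating (op {E = E} F v _) =
  Operation.++-totalDominating E v (core-totalDominating F) P6-core-totalDominating

core-minimal : ∀ {n E S} (F : InFamily n E S) (D : Subset n) →
  (∀ x → S x ≢ B → HasNeighbourIn E D x) → ∣ core F ∣ ≤ ∣ D ∣
core-minimal base D D-dom = P6-core-minimal D D-dom
core-minimal (op {n} {E} {S} F v Sv≡B) D D-dom with Vec.splitAt n D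
... | L , R , refl = begin
  ∣ core F ++ P6-core ∣     ≡⟨ ∣p++q∣≡∣p∣+∣q∣ (core F) P6-core ⟩
  ∣ core F ∣ + ∣ P6-core ∣  ≤⟨ +-mono-≤ (core-minimal F L L-dom) (P6-core-minimal R R-dom) ⟩
  ∣ L ∣ + ∣ R ∣             ≡⟨ ∣p++q∣≡∣p∣+∣q∣ L R ⟨
  ∣ L ++ R ∣                ∎
  where
  open ≤-Reasoning
  open Operation E v
  L-dom : ∀ x → S x ≢ B → HasNeighbourIn E L x
  L-dom x Sx≢B = hasNeighbourIn-↑ˡ⁻ (λ x≡v → Sx≢B (trans (cong S x≡v) Sv≡B))
                                    (D-dom (x ↑ˡ 6) (Sx≢B ∘ trans (sym (opStatus-↑ˡ S x))))
  R-dom : ∀ j → pathStatus j ≢ B → HasNeighbourIn P6Edges R j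
  R-dom j j≢B = hasNeighbourIn-↑ʳ⁻ (j≢B ∘ cong pathStatus)
                                   (D-dom (n ↑ʳ j) (j≢B ∘ trans (sym (opStatus-↑ʳ S j))))

core-punctured : ∀ {n E S} (F : InFamily n E S) v →
  AtMostOneNeighbour E v → PuncturedDominator E ∣ core F ∣ v
core-punctured base j unique = P6-punctured j unique
core-punctured (op {n} {E} F v _) a unique with splitView n 6 a
... | ↑ˡ-view x = punctured-↑ˡ {D = core F} P6-core-totalDominating
                    (core-punctured F x (atMostOneNeighbour-↑ˡ⁻ unique))
  where open Operation E v
... | ↑ʳ-view j = punctured-↑ʳ (core-totalDominating F)
                    (P6-punctured j (atMostOneNeighbour-↑ʳ⁻ unique))
  where open Operation E v

∣core∣≡γ : ∀ {n E S} (F : InFamily n E S) {γ} → IsTotalDominationNumber E γ → ∣ core F ∣ ≡ γ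
∣core∣≡γ F ((D , D-dom , ∣D∣≡γ) , γ-minimal) =
  ≤-antisym (≤-trans (core-minimal F D (λ x _ → D-dom x)) (≤-reflexive ∣D∣≡γ))
            (γ-minimal (core F) (core-totalDominating F))

lemma2p10 : (n : ℕ) (E : Edges n) (S : Fin n → Status) → InFamily n E S →
    (γ : ℕ) → IsTotalDominationNumber E γ →
    (v : Fin n) → Leaf E v →
    ∃[ X ] ((∣ X ∣ ≡ γ ∸ 1) × (v ∈ X) ×
    ((x : Fin n) → x ≢ v → ∃[ y ] ((y ∈ X) × Adj E x y)))
lemma2p10 n E S F γ γ-spec v leaf with core-punctured F v (Leaf⇒AtMostOneNeighbour leaf)
... | X , size , v∈X , X-dom = X , cong (_∸ 1) (trans size (∣core∣≡γ F γ-spec)) , v∈X , X-dom
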